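{- Let $\mathrm{asort}$ be the bottom-up abstract mergesort: for types $T,R$, $m : R \to R \to R$, $s : T \to R$, $e : R$, define on lists of elements of $R$: $\mathrm{merge\_pairs}\,(a :: b :: xs) = m\,a\,b :: \mathrm{merge\_pairs}\,xs$ and $\mathrm{merge\_pairs}\,xs = xs$ if $xs$ has length less than $2$; $\mathrm{merge\_all}\,[] = e$, $\mathrm{merge\_all}\,[x] = x$, and $\mathrm{merge\_all}\,xs = \mathrm{merge\_all}\,(\mathrm{merge\_pairs}\,xs)$ if $xs$ has length at least $2$; and $\mathrm{asort}\,m\,s\,e\,xs = \mathrm{merge\_all}\,(\mathrm{map}\,s\,xs)$. Then for every type $T$ and every $xs : \mathrm{list}\,T$, $\mathrm{asort}\,(\mathbin{+\!\!+})\,(\lambda x.[x])\,[]\,xs = xs$.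
   Context: $\mathbin{+\!\!+}$ is list concatenation, $[x]$ the singleton list, $[]$ the empty list, and $\mathrm{map}\,s\,[a_1,\dots,a_n] = [s\,a_1,\dots,s\,a_n]$. -}

module Defs where

open import Level using (Level)
open import Data.Nat using (ℕ; zero; suc)
open import Data.List using (List; []; _∷_; map; length)

private
  variable
    a b : Level
    T : Set a
    R : Set b

merge-pairs : (R → R → R) → List R → List R
merge-pairs m (x ∷ y ∷ xs) = m x y ∷ merge-pairs m xs
merge-pairs m xs           = xs

-- merge_all is not structurally recursive; we use fuel. With fuel = length xs
-- the fuel never runs out (merge-pairs strictly shortens lists of length ≥ 2),
-- so merge-all below satisfies exactly the paper's defining equations.
merge-all-fuel : ℕ → (R → R → R) → R → List R → R
merge-all-fuel _       m e []           = e
merge-all-fuel _       m e (x ∷ [])     = x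
merge-all-fuel zero    m e (x ∷ y ∷ xs) = e  -- unreachable when fuel = length
merge-all-fuel (suc n) m e (x ∷ y ∷ xs) =
  merge-all-fuel n m e (merge-pairs m (x ∷ y ∷ xs))

merge-all : (R → R → R) → R → List R → R
merge-all m e xs = merge-all-fuel (length xs) m e xs

asort : (R → R → R) → (T → R) → R → List T → R
asort m s e xs = merge-all m e (map s xs)

-- Merging adjacent pairs with an associative operation does not change the
-- right fold of the list, and each round shortens a list of length ≥ 2, so
-- the fuel length xs suffices and merge-all computes the fold foldr m e.
-- For m = _++_ and singleton leaves that fold is concat ∘ map [_].
module Submission where

open import Defs
open import Level using (Level)
open import Algebra.Definitions using (Associative; RightIdentity)
open import Data.List using (List; []; _∷_; _++_; [_]; foldr; concat; length; map)
open import Data.List.Properties using (++-assoc; ++-identityʳ)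
open import Data.Nat using (suc; _≤_; s≤s; z≤n)
open import Data.Nat.Properties using (≤-refl; m≤n⇒m≤1+n; ≤-trans)
open import Relation.Binary.PropositionalEquality using (_≡_; refl; cong; sym; trans; module ≡-Reasoning)

module _ {a : Level} {R : Set a} (m : R → R → R) where

  length-merge-pairs : (xs : List R) → length (merge-pairs m xs) ≤ length xs
  length-merge-pairs []           = z≤n
  length-merge-pairs (x ∷ [])     = ≤-refl
  length-merge-pairs (x ∷ y ∷ xs) = s≤s (m≤n⇒m≤1+n (length-merge-pairs xs))

  module _ (e : R) (assoc : Associative _≡_ m) where

    foldr-merge-pairs : (xs : List R) → foldr m e (merge-pairs m xs) ≡ foldr m e xs
    foldr-merge-pairs []           = refl
    foldr-merge-pairs (x ∷ [])     = refl
    foldr-merge-pairs (x ∷ y ∷ xs) = begin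
      m (m x y) (foldr m e (merge-pairs m xs)) ≡⟨ cong (m (m x y)) (foldr-merge-pairs xs) ⟩
      m (m x y) (foldr m e xs)                 ≡⟨ assoc x y (foldr m e xs) ⟩
      m x (m y (foldr m e xs))                 ∎
      where open ≡-Reasoning

    module _ (identityʳ : RightIdentity _≡_ e m) where

      merge-all-fuel≡foldr : ∀ n xs → length xs ≤ suc n → merge-all-fuel n m e xs ≡ foldr m e xs
      merge-all-fuel≡foldr n       []           _                = refl
      merge-all-fuel≡foldr n       (x ∷ [])     _                = sym (identityʳ x)
      merge-all-fuel≡foldr (suc n) (x ∷ y ∷ xs) (s≤s (s≤s len≤)) =
        trans (merge-all-fuel≡foldr n (m x y ∷ merge-pairs m xs)
                                    (s≤s (≤-trans (length-merge-pairs xs) len≤)))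
              (foldr-merge-pairs (x ∷ y ∷ xs))

      merge-all≡foldr : (xs : List R) → merge-all m e xs ≡ foldr m e xs
      merge-all≡foldr xs = merge-all-fuel≡foldr (length xs) xs (m≤n⇒m≤1+n ≤-refl)

concat-map-[_] : ∀ {ℓ} {T : Set ℓ} (xs : List T) → concat (map [_] xs) ≡ xs
concat-map-[ [] ]     = refl
concat-map-[ x ∷ xs ] = cong (x ∷_) concat-map-[ xs ]

lemma3p4 : ∀ {ℓ : Level} (T : Set ℓ) (xs : List T) → asort _++_ (λ x → x ∷ []) [] xs ≡ xs
lemma3p4 T xs = begin
  merge-all _++_ [] (map [_] xs) ≡⟨ merge-all≡foldr _++_ [] ++-assoc ++-identityʳ (map [_] xs) ⟩
  concat (map [_] xs)            ≡⟨ concat-map-[ xs ] ⟩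
  xs                             ∎
  where open ≡-Reasoning
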